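{- For all integers $a \ge 1$ and $1 \le j \le 5$, $\mathrm{dor}(a,2a+j) \le 4$.
   Context: For integers $1 \le a \le b$, an $(a,b)$-triple is a triple $(x, ax+d, bx+2d)$ with $x,d$ positive integers. A coloring admits a monochromatic $(a,b)$-triple if all three entries of some $(a,b)$-triple receive the same color. The pair $(a,b)$ is $r$-regular if every $r$-coloring of $\mathbb{N}$ admits a monochromatic $(a,b)$-triple. The degree of regularity $\mathrm{dor}(a,b)$ is the largest $r$ such that $(a,b)$ is $r$-regular, and $\mathrm{dor}(a,b)=\infty$ if $(a,b)$ is $r$-regular for all $r$. -}

module Defs where

open import Data.Nat using (ℕ; suc; _+_; _*_)
open import Data.Fin using (Fin)
open import Data.Empty using (⊥)
open import Data.Product using (∃-syntax; _×_)
open import Relation.Binary.PropositionalEquality using (_≡_)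

-- An r-coloring of the positive integers, encoded as a map ℕ → Fin r
-- (the value at 0 is irrelevant, since all triple entries are positive).
Coloring : ℕ → Set
Coloring r = ℕ → Fin r

-- c admits a monochromatic (a,b)-triple (x, a x + d, b x + 2 d) with x, d ≥ 1.
-- Positivity of x and d is encoded by writing x = suc x', d = suc d'.
MonoTriple : ∀ {r} → ℕ → ℕ → Coloring r → Set
MonoTriple a b c =
  ∃[ x' ] ∃[ d' ]
    (c (suc x') ≡ c (a * suc x' + suc d') ×
     c (suc x') ≡ c (b * suc x' + 2 * suc d'))

Regular : ℕ → ℕ → ℕ → Set
Regular r a b = (c : Coloring r) → MonoTriple a b c

-- dor(a,b) ≤ k  iff  (a,b) is not (k+1)-regular
-- (r-regularity is downward closed in r, and dor is the largest r that is regular).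
DorAtMost : ℕ → ℕ → ℕ → Set
DorAtMost k a b = Regular (suc k) a b → ⊥

{-# OPTIONS --safe #-}
module Submission where

-- Color n by ⌊log₂ n⌋ mod 5.  In an (a, 2a+j)-triple (x, y, z) we have
-- z = 2y + jx and x ≤ y, so 2y ≤ z ≤ (2+j)y ≤ 2⁴y.  Hence ⌊log₂ z⌋ exceeds
-- ⌊log₂ y⌋ by 1, 2, 3 or 4, so y and z already receive different colors.

open import Defs
open import Data.Nat using (ℕ; suc; _+_; _*_; _∸_; _^_; _≤_; _<_; _%_; _/_; NonZero; >-nonZero; s≤s; z<s)
open import Data.Nat.Properties
open import Data.Nat.DivMod using (_mod_; m≡m%n+[m/n]*n)
open import Data.Nat.Divisibility using (_∣_; n∣m*n; ∣m+n∣m⇒∣n; >⇒∤)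
open import Data.Nat.Logarithm using (⌊log₂_⌋; ⌊log₂⌋-mono-≤; ⌊log₂[2*b]⌋≡1+⌊log₂b⌋)
open import Data.Nat.Tactic.RingSolver using (solve-∀)
open import Data.Fin using (toℕ)
open import Data.Fin.Properties using (toℕ-fromℕ<)
open import Data.Product using (_,_)
open import Relation.Binary.PropositionalEquality

[m+i]%n≡m%n⇒n∣i : ∀ m i n .{{_ : NonZero n}} → (m + i) % n ≡ m % n → n ∣ i
[m+i]%n≡m%n⇒n∣i m i n eq = ∣m+n∣m⇒∣n (subst (n ∣_) quotients (n∣m*n ((m + i) / n))) (n∣m*n (m / n))
  where
  open ≡-Reasoning
  quotients : (m + i) / n * n ≡ m / n * n + i
  quotients = +-cancelˡ-≡ (m % n) _ _ (begin
    m % n + (m + i) / n * n        ≡⟨ cong (_+ (m + i) / n * n) eq ⟨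
    (m + i) % n + (m + i) / n * n  ≡⟨ m≡m%n+[m/n]*n (m + i) n ⟨
    m + i                          ≡⟨ cong (_+ i) (m≡m%n+[m/n]*n m n) ⟩
    m % n + m / n * n + i          ≡⟨ +-assoc (m % n) (m / n * n) i ⟩
    m % n + (m / n * n + i)        ∎)

[m+i]%n≢m%n : ∀ m {i n} .{{_ : NonZero n}} → 0 < i → i < n → (m + i) % n ≢ m % n
[m+i]%n≢m%n m {i} {n} 0<i i<n eq = >⇒∤ {{>-nonZero 0<i}} i<n ([m+i]%n≡m%n⇒n∣i m i n eq)

⌊log₂[2^k*n]⌋≡k+⌊log₂n⌋ : ∀ k n .{{_ : NonZero n}} → ⌊log₂ (2 ^ k * n) ⌋ ≡ k + ⌊log₂ n ⌋
⌊log₂[2^k*n]⌋≡k+⌊log₂n⌋ 0       n = cong ⌊log₂_⌋ (*-identityˡ n)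
⌊log₂[2^k*n]⌋≡k+⌊log₂n⌋ (suc k) n = begin
  ⌊log₂ (2 * 2 ^ k * n) ⌋    ≡⟨ cong ⌊log₂_⌋ (*-assoc 2 (2 ^ k) n) ⟩
  ⌊log₂ (2 * (2 ^ k * n)) ⌋  ≡⟨ ⌊log₂[2*b]⌋≡1+⌊log₂b⌋ (2 ^ k * n) {{2^k*n≢0}} ⟩
  suc ⌊log₂ (2 ^ k * n) ⌋    ≡⟨ cong suc (⌊log₂[2^k*n]⌋≡k+⌊log₂n⌋ k n) ⟩
  suc (k + ⌊log₂ n ⌋)        ∎
  where
  open ≡-Reasoning
  2^k*n≢0 : NonZero (2 ^ k * n)
  2^k*n≢0 = m*n≢0 (2 ^ k) n {{m^n≢0 2 k}}

2*n≤m⇒⌊log₂n⌋<⌊log₂m⌋ : ∀ {m} n .{{_ : NonZero n}} → 2 * n ≤ m → ⌊log₂ n ⌋ < ⌊log₂ m ⌋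
2*n≤m⇒⌊log₂n⌋<⌊log₂m⌋ n 2n≤m = subst (_≤ _) (⌊log₂[2*b]⌋≡1+⌊log₂b⌋ n) (⌊log₂⌋-mono-≤ 2n≤m)

m≤2^k*n⇒⌊log₂m⌋≤k+⌊log₂n⌋ : ∀ {m} k n .{{_ : NonZero n}} → m ≤ 2 ^ k * n → ⌊log₂ m ⌋ ≤ k + ⌊log₂ n ⌋
m≤2^k*n⇒⌊log₂m⌋≤k+⌊log₂n⌋ k n m≤2^kn = subst (_ ≤_) (⌊log₂[2^k*n]⌋≡k+⌊log₂n⌋ k n) (⌊log₂⌋-mono-≤ m≤2^kn)

log₂Coloring : (r : ℕ) .{{_ : NonZero r}} → Coloring r
log₂Coloring r n = ⌊log₂ n ⌋ mod r

log₂Coloring-separates : ∀ k {y z} .{{_ : NonZero y}} → 2 * y ≤ z → z ≤ 2 ^ k * y →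
                         log₂Coloring (suc k) y ≢ log₂Coloring (suc k) z
log₂Coloring-separates k {y} {z} 2y≤z z≤2^ky same =
  [m+i]%n≢m%n L (m<n⇒0<n∸m L<M) (s≤s M∸L≤k) sameRemainder
  where
  L = ⌊log₂ y ⌋
  M = ⌊log₂ z ⌋
  L<M : L < M
  L<M = 2*n≤m⇒⌊log₂n⌋<⌊log₂m⌋ y 2y≤z
  M≤k+L : M ≤ k + L
  M≤k+L = m≤2^k*n⇒⌊log₂m⌋≤k+⌊log₂n⌋ k y z≤2^ky
  M∸L≤k : M ∸ L ≤ k
  M∸L≤k = ≤-trans (∸-monoˡ-≤ L M≤k+L) (≤-reflexive (m+n∸n≡m k L))
  sameRemainder : (L + (M ∸ L)) % suc k ≡ L % suc k
  sameRemainder = begin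
    (L + (M ∸ L)) % suc k  ≡⟨ cong (_% suc k) (m+[n∸m]≡n (<⇒≤ L<M)) ⟩
    M % suc k              ≡⟨ toℕ-fromℕ< _ ⟨
    toℕ (M mod suc k)      ≡⟨ cong toℕ same ⟨
    toℕ (L mod suc k)      ≡⟨ toℕ-fromℕ< _ ⟩
    L % suc k              ∎
    where open ≡-Reasoning

[2a+j]x+2d≡2[ax+d]+jx : ∀ a j x d → (2 * a + j) * x + 2 * d ≡ 2 * (a * x + d) + j * x
[2a+j]x+2d≡2[ax+d]+jx = solve-∀

2[ax+d]≤[2a+j]x+2d : ∀ a j x d → 2 * (a * x + d) ≤ (2 * a + j) * x + 2 * d
2[ax+d]≤[2a+j]x+2d a j x d =
  subst (2 * (a * x + d) ≤_) (sym ([2a+j]x+2d≡2[ax+d]+jx a j x d)) (m≤m+n (2 * (a * x + d)) (j * x))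

[2a+j]x+2d≤[2+j][ax+d] : ∀ {a} j x d .{{_ : NonZero a}} → (2 * a + j) * x + 2 * d ≤ (2 + j) * (a * x + d)
[2a+j]x+2d≤[2+j][ax+d] {a} j x d = begin
  (2 * a + j) * x + 2 * d  ≡⟨ [2a+j]x+2d≡2[ax+d]+jx a j x d ⟩
  2 * y + j * x            ≤⟨ +-monoʳ-≤ (2 * y) (*-monoʳ-≤ j x≤y) ⟩
  2 * y + j * y            ≡⟨ *-distribʳ-+ y 2 j ⟨
  (2 + j) * y              ∎
  where
  open ≤-Reasoning
  y = a * x + d
  x≤y : x ≤ y
  x≤y = ≤-trans (m≤n*m x a) (m≤m+n (a * x) d)

corollary1 : (a j : ℕ) → 1 ≤ a → 1 ≤ j → j ≤ 5 → DorAtMost 4 a (2 * a + j)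
corollary1 a j 1≤a _ j≤5 regular with regular (log₂Coloring 5)
... | x′ , d′ , c[x]≡c[y] , c[x]≡c[z] =
  log₂Coloring-separates 4 {{y≢0}} (2[ax+d]≤[2a+j]x+2d a j x d) z≤2^4y (trans (sym c[x]≡c[y]) c[x]≡c[z])
  where
  x = suc x′
  d = suc d′
  y≢0 : NonZero (a * x + d)
  y≢0 = >-nonZero (<-≤-trans z<s (m≤n+m d (a * x)))
  2+j≤2^4 : 2 + j ≤ 2 ^ 4
  2+j≤2^4 = ≤-trans (+-monoʳ-≤ 2 j≤5) (m≤m+n 7 9)
  z≤2^4y : (2 * a + j) * x + 2 * d ≤ 2 ^ 4 * (a * x + d)
  z≤2^4y = ≤-trans ([2a+j]x+2d≤[2+j][ax+d] j x d {{>-nonZero 1≤a}}) (*-monoˡ-≤ (a * x + d) 2+j≤2^4)
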